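{- Let $m\ge 2$ and let $\mathbf{v}=(v_1,\ldots,v_m)$, $\mathbf{k}=(k_1,\ldots,k_m)$ be $m$-tuples of positive integers with $\mathbf{v}\ge\mathbf{k}$ componentwise. Then $$D(\mathbf{v},\mathbf{k},2)\le\min\left\{\min_{i:\,k_i\ge2}D(v_i,k_i,2),\ \min_{\substack{i,j\in\{1,\ldots,m\}\\ i\ne j}}\left\lfloor\frac{v_i}{k_i}\left\lfloor\frac{v_j}{k_j}\right\rfloor\right\rfloor\right\}.$$
   Context: Let $X_1,\ldots,X_m$ be pairwise disjoint sets with $|X_i|=v_i$. A block is an $m$-tuple $(B_1,\ldots,B_m)$ with $B_i\subseteq X_i$, $|B_i|=k_i$. An $m$-tuple $(T_1,\ldots,T_m)$ is admissible if $T_i\subseteq X_i$, $|T_i|\le k_i$, and $\sum_i|T_i|=2$; it is contained in a block if $T_i\subseteq B_i$ for all $i$. A $2$-$(\mathbf{v},\mathbf{k},1)$ generalized packing is a family of blocks such that every admissible $m$-tuple is contained in at most one block. $D(\mathbf{v},\mathbf{k},2)$ is the maximum number of blocks in such a generalized packing. For integers $v\ge k\ge 2$, $D(v,k,2)$ is the maximum number of $k$-subsets of a $v$-set such that every $2$-subset lies in at most one of them. An empty minimum is interpreted as $+\infty$. -}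

module Defs where

open import Data.Nat using (ℕ; zero; suc; _+_; _*_; _≤_; _/_)
open import Data.Fin using (Fin; zero; suc)
open import Data.Fin.Subset using (Subset; _⊆_; ∣_∣)
open import Data.Product using (Σ; _×_; ∃; proj₁)
open import Relation.Binary.PropositionalEquality using (_≡_; _≢_)
open import Relation.Nullary using (¬_)

∑ : ∀ {m} → (Fin m → ℕ) → ℕ
∑ {zero}  f = 0
∑ {suc m} f = f zero + ∑ (λ i → f (suc i))

-- Floor division; the divisor-zero case is never used (all k_i ≥ 1).
_div_ : ℕ → ℕ → ℕ
a div zero    = 0
a div (suc b) = a / suc b

record Packing (v k n : ℕ) : Set where
  field
    block      : Fin n → Subset v
    block-size : ∀ a → ∣ block a ∣ ≡ k
    at-most-one : ∀ a b → a ≢ b → (T : Subset v) → ∣ T ∣ ≡ 2 →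
                  ¬ (T ⊆ block a × T ⊆ block b)

IsD : ℕ → ℕ → ℕ → Set
IsD v k d = Packing v k d × (∀ n → Packing v k n → n ≤ d)

-- Generalized packings: D(𝐯,𝐤,2), X_i = Fin (v i)

Block : ∀ {m} → (v k : Fin m → ℕ) → Set
Block {m} v k = Σ ((i : Fin m) → Subset (v i)) λ B → ∀ i → ∣ B i ∣ ≡ k i

Admissible : ∀ {m} → (v k : Fin m → ℕ) → ((i : Fin m) → Subset (v i)) → Set
Admissible v k T = (∀ i → ∣ T i ∣ ≤ k i) × ∑ (λ i → ∣ T i ∣) ≡ 2

ContainedIn : ∀ {m} {v k : Fin m → ℕ} → ((i : Fin m) → Subset (v i)) → Block v k → Set
ContainedIn T B = ∀ i → T i ⊆ proj₁ B i

record GenPacking {m} (v k : Fin m → ℕ) (n : ℕ) : Set where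
  field
    block : Fin n → Block v k
    at-most-one : ∀ a b → a ≢ b → (T : (i : Fin m) → Subset (v i)) →
                  Admissible v k T →
                  ¬ (ContainedIn T (block a) × ContainedIn T (block b))

IsGenD : ∀ {m} → (v k : Fin m → ℕ) → ℕ → Set
IsGenD v k d = GenPacking v k d × (∀ n → GenPacking v k n → n ≤ d)

module Submission where

open import Defs
open import Data.Nat using (ℕ; _*_; _≤_)
open import Data.Fin using (Fin)
open import Data.Product using (_×_)
open import Relation.Binary.PropositionalEquality using (_≢_)

open import Data.Nat using (zero; suc; _+_; _/_; z≤n)
open import Data.Nat.Properties
  using (+-*-semiring; +-identityʳ; +-mono-≤; *-identityʳ; *-mono-≤; ≤-refl; ≰⇒>; n<1⇒n≡0; _≤?_; module ≤-Reasoning)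
open import Data.Nat.DivMod using (m*n/n≡m; /-monoˡ-≤)
open import Data.Fin using (zero; suc)
open import Data.Fin.Properties using (_≟_; suc-injective)
open import Data.Fin.Subset using (Subset; _⊆_; _∈_; _∪_; ∣_∣; ⊥; ⁅_⁆)
open import Data.Fin.Subset.Properties
  using (∣⊥∣≡0; ∣⁅x⁆∣≡1; ⊥⊆; x∈⁅y⁆⇒x≡y; x∈p∪q⁻; ∪-identityˡ; ∪-identityʳ)
open import Data.Vec using ([]; _∷_; lookup)
open import Data.Vec.Properties using (lookup⇒[]=)
open import Data.Bool using (true; false; if_then_else_)
open import Data.Product using (_,_; proj₁; proj₂)
open import Data.Sum using (_⊎_; inj₁; inj₂; [_,_])
open import Data.Empty using (⊥-elim)
open import Relation.Nullary using (yes; no; ¬_)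
open import Relation.Binary.PropositionalEquality
  using (_≡_; refl; sym; trans; cong; cong₂; subst; module ≡-Reasoning)
open import Function using (_∘_)
open import Algebra.Properties.Semiring.Sum +-*-semiring
  using (sum; sum-cong-≗; ∑-comm; ∑-distrib-+; *-distribˡ-sum; *-distribʳ-sum)

-- Proof idea.  Let B_1,…,B_d be the blocks of a maximum generalized
-- packing, B_a = (B_a1,…,B_am).
--
-- (1) For k_i ≥ 2 the i-th parts B_1i,…,B_di form a classical packing of
--     k_i-subsets of X_i: a 2-subset T ⊆ X_i, placed in coordinate i and
--     padded by empty sets elsewhere, is an admissible tuple.  Hence d ≤ D(v_i,k_i,2).
-- (2) For i ≠ j and x ∈ X_i, y ∈ X_j the tuple with {x} at i and {y} at j is
--     admissible, so at most one block has x ∈ B_ai and y ∈ B_aj.  A purely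
--     combinatorial double-counting lemma (the "bipartite pair-packing bound")
--     then gives d·k_i ≤ v_i·⌊v_j/k_j⌋.

∑≡sum : ∀ {n} (f : Fin n → ℕ) → ∑ f ≡ sum f
∑≡sum {zero}  f = refl
∑≡sum {suc n} f = cong (f zero +_) (∑≡sum (f ∘ suc))

sum-const : ∀ n (c : ℕ) → sum {n} (λ _ → c) ≡ n * c
sum-const zero    c = refl
sum-const (suc n) c = cong (c +_) (sum-const n c)

sum-mono-≤ : ∀ {n} {f g : Fin n → ℕ} → (∀ a → f a ≤ g a) → sum f ≤ sum g
sum-mono-≤ {zero}  f≤g = z≤n
sum-mono-≤ {suc n} f≤g = +-mono-≤ (f≤g zero) (sum-mono-≤ (f≤g ∘ suc))

sum-zero : ∀ {n} (f : Fin n → ℕ) → (∀ a → f a ≡ 0) → sum f ≡ 0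
sum-zero {zero}  f f≡0 = refl
sum-zero {suc n} f f≡0 = cong₂ _+_ (f≡0 zero) (sum-zero (f ∘ suc) (f≡0 ∘ suc))

sum-pointed : ∀ {n} (f : Fin n → ℕ) (i : Fin n) → (∀ l → l ≢ i → f l ≡ 0) → sum f ≡ f i
sum-pointed {suc n} f zero    off = trans (cong (f zero +_) (sum-zero (f ∘ suc) (λ l → off (suc l) λ ())))
                                          (+-identityʳ (f zero))
sum-pointed {suc n} f (suc i) off = cong₂ _+_ (off zero λ ())
                                          (sum-pointed (f ∘ suc) i (λ l l≢i → off (suc l) (l≢i ∘ suc-injective)))

not-positive : ∀ {n} → ¬ (1 ≤ n) → n ≡ 0
not-positive n≱1 = n<1⇒n≡0 (≰⇒> n≱1)

sum-atMostOne : ∀ {n} (f : Fin n → ℕ) → (∀ a → f a ≤ 1) →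
                (∀ a b → 1 ≤ f a → 1 ≤ f b → a ≡ b) → sum f ≤ 1
sum-atMostOne {zero}  f f≤1 unique = z≤n
sum-atMostOne {suc n} f f≤1 unique with 1 ≤? f zero
... | yes f₀≥1 = subst (λ t → f zero + t ≤ 1) (sym (sum-zero (f ∘ suc) tail-zero))
                       (subst (_≤ 1) (sym (+-identityʳ (f zero))) (f≤1 zero))
  where
  tail-zero : ∀ a → f (suc a) ≡ 0
  tail-zero a with 1 ≤? f (suc a)
  ... | yes fₐ≥1 with () ← unique zero (suc a) f₀≥1 fₐ≥1
  ... | no  fₐ≱1 = not-positive fₐ≱1
... | no  f₀≱1 = subst (λ t → t + sum (f ∘ suc) ≤ 1) (sym (not-positive f₀≱1))
                       (sum-atMostOne (f ∘ suc) (f≤1 ∘ suc)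
                         (λ a b fa fb → suc-injective (unique (suc a) (suc b) fa fb)))

ind : ∀ {n} → Subset n → Fin n → ℕ
ind S x = if lookup S x then 1 else 0

ind≤1 : ∀ {n} (S : Subset n) x → ind S x ≤ 1
ind≤1 S x with lookup S x
... | true  = ≤-refl
... | false = z≤n

ind-*-∈ : ∀ {n p} (S : Subset n) (R : Subset p) x y →
          1 ≤ ind S x * ind R y → x ∈ S × y ∈ R
ind-*-∈ S R x y positive with lookup S x in x∈S | lookup R y in y∈R | positive
... | true | true | _ = lookup⇒[]= x S x∈S , lookup⇒[]= y R y∈R

∣∣≡sum-ind : ∀ {n} (S : Subset n) → ∣ S ∣ ≡ sum (ind S)
∣∣≡sum-ind []          = refl
∣∣≡sum-ind (true ∷ S)  = cong suc (∣∣≡sum-ind S)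
∣∣≡sum-ind (false ∷ S) = ∣∣≡sum-ind S

≤-div : ∀ {a b c} → 1 ≤ c → a * c ≤ b → a ≤ b div c
≤-div {a} {b} {suc c} _ a*c≤b = subst (_≤ b / suc c) (m*n/n≡m a (suc c)) (/-monoˡ-≤ (suc c) a*c≤b)

-- Each x lies in r_x of the A_a, whose
-- C_a are pairwise disjoint, so r_x·t ≤ q; summing r_x over x counts
-- every A_a once, so d·s = Σ r_x ≤ p⌊q/t⌋.

module PairPacking {d p q s t : ℕ} (A : Fin d → Subset p) (C : Fin d → Subset q)
  (A-size : ∀ a → ∣ A a ∣ ≡ s) (C-size : ∀ a → ∣ C a ∣ ≡ t)
  (unique : ∀ x y a b → x ∈ A a → y ∈ C a → x ∈ A b → y ∈ C b → a ≡ b) where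

  degree : Fin p → ℕ
  degree x = sum (λ a → ind (A a) x)

  pair-covered-once : ∀ x y → sum (λ a → ind (A a) x * ind (C a) y) ≤ 1
  pair-covered-once x y =
    sum-atMostOne _ (λ a → *-mono-≤ (ind≤1 (A a) x) (ind≤1 (C a) y)) same-index
    where
    same-index : ∀ a b → 1 ≤ ind (A a) x * ind (C a) y → 1 ≤ ind (A b) x * ind (C b) y → a ≡ b
    same-index a b pa pb with ind-*-∈ (A a) (C a) x y pa | ind-*-∈ (A b) (C b) x y pb
    ... | x∈Aa , y∈Ca | x∈Ab , y∈Cb = unique x y a b x∈Aa y∈Ca x∈Ab y∈Cb

  degree-bound : ∀ x → degree x * t ≤ q
  degree-bound x = begin
    degree x * t                                          ≡⟨ *-distribʳ-sum t (λ a → ind (A a) x) ⟩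
    sum (λ a → ind (A a) x * t)                           ≡⟨ sum-cong-≗ (λ a → cong (ind (A a) x *_) t≡∑C) ⟩
    sum (λ a → ind (A a) x * sum (ind (C a)))             ≡⟨ sum-cong-≗ (λ a → *-distribˡ-sum (ind (A a) x) (ind (C a))) ⟩
    sum (λ a → sum (λ y → ind (A a) x * ind (C a) y))     ≡⟨ ∑-comm (λ a y → ind (A a) x * ind (C a) y) ⟩
    sum (λ y → sum (λ a → ind (A a) x * ind (C a) y))     ≤⟨ sum-mono-≤ (pair-covered-once x) ⟩
    sum {q} (λ _ → 1)                                     ≡⟨ trans (sum-const q 1) (*-identityʳ q) ⟩
    q                                                     ∎
    where
    open ≤-Reasoning
    t≡∑C : ∀ {a} → t ≡ sum (ind (C a))
    t≡∑C {a} = trans (sym (C-size a)) (∣∣≡sum-ind (C a))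

  size-count : d * s ≡ sum degree
  size-count = begin
    d * s                                ≡⟨ sym (sum-const d s) ⟩
    sum {d} (λ _ → s)                    ≡⟨ sum-cong-≗ (λ a → trans (sym (A-size a)) (∣∣≡sum-ind (A a))) ⟩
    sum (λ a → sum (λ x → ind (A a) x))  ≡⟨ ∑-comm (λ a x → ind (A a) x) ⟩
    sum degree                           ∎
    where open ≡-Reasoning

  bound : 1 ≤ s → 1 ≤ t → d ≤ (p * (q div t)) div s
  bound s≥1 t≥1 = ≤-div s≥1 (begin
    d * s               ≡⟨ size-count ⟩
    sum degree          ≤⟨ sum-mono-≤ (λ x → ≤-div t≥1 (degree-bound x)) ⟩
    sum {p} (λ _ → q div t) ≡⟨ sum-const p (q div t) ⟩
    p * (q div t)       ∎)
    where open ≤-Reasoning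

⁅⁆⊆ : ∀ {n} {x : Fin n} {S : Subset n} → x ∈ S → ⁅ x ⁆ ⊆ S
⁅⁆⊆ {S = S} x∈S z∈⁅x⁆ = subst (_∈ S) (sym (x∈⁅y⁆⇒x≡y _ z∈⁅x⁆)) x∈S

∪-⊆ : ∀ {n} {P Q R : Subset n} → P ⊆ R → Q ⊆ R → P ∪ Q ⊆ R
∪-⊆ {P = P} {Q} P⊆R Q⊆R z∈P∪Q = [ P⊆R , Q⊆R ] (x∈p∪q⁻ P Q z∈P∪Q)

∣∪∣-with-∅ : ∀ {n} (P Q : Subset n) → P ≡ ⊥ ⊎ Q ≡ ⊥ → ∣ P ∪ Q ∣ ≡ ∣ P ∣ + ∣ Q ∣
∣∪∣-with-∅ {n} P Q (inj₁ refl) = trans (cong ∣_∣ (∪-identityˡ Q)) (cong (_+ ∣ Q ∣) (sym (∣⊥∣≡0 n)))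
∣∪∣-with-∅ {n} P Q (inj₂ refl) = trans (cong ∣_∣ (∪-identityʳ P)) (trans (sym (+-identityʳ ∣ P ∣))
                                                                     (cong (∣ P ∣ +_) (sym (∣⊥∣≡0 n))))

∣∪∣-with-∅-≤ : ∀ {n c} (P Q : Subset n) → P ≡ ⊥ ⊎ Q ≡ ⊥ → ∣ P ∣ ≤ c → ∣ Q ∣ ≤ c → ∣ P ∪ Q ∣ ≤ c
∣∪∣-with-∅-≤ {c = c} P Q (inj₁ refl) _   ∣Q∣≤c = subst (_≤ c) (sym (cong ∣_∣ (∪-identityˡ Q))) ∣Q∣≤c
∣∪∣-with-∅-≤ {c = c} P Q (inj₂ refl) ∣P∣≤c _   = subst (_≤ c) (sym (cong ∣_∣ (∪-identityʳ P))) ∣P∣≤c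

module _ {m : ℕ} {v : Fin m → ℕ} where

  point : (i : Fin m) → Subset (v i) → (l : Fin m) → Subset (v l)
  point i S l with l ≟ i
  ... | yes refl = S
  ... | no  _    = ⊥

  point-at : ∀ i (S : Subset (v i)) → point i S i ≡ S
  point-at i S with i ≟ i
  ... | yes refl = refl
  ... | no  i≢i  = ⊥-elim (i≢i refl)

  point-off : ∀ {i l} (S : Subset (v i)) → l ≢ i → point i S l ≡ ⊥
  point-off {i} {l} S l≢i with l ≟ i
  ... | yes l≡i = ⊥-elim (l≢i l≡i)
  ... | no  _   = refl

  ∣point∣-sum : ∀ i (S : Subset (v i)) → sum (λ l → ∣ point i S l ∣) ≡ ∣ S ∣
  ∣point∣-sum i S = trans (sum-pointed _ i (λ l l≢i → trans (cong ∣_∣ (point-off S l≢i)) (∣⊥∣≡0 (v l))))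
                          (cong ∣_∣ (point-at i S))

  point-size≤ : ∀ (k : Fin m → ℕ) {i} {S : Subset (v i)} → ∣ S ∣ ≤ k i → ∀ l → ∣ point i S l ∣ ≤ k l
  point-size≤ k {i} ∣S∣≤k l with l ≟ i
  ... | yes refl = ∣S∣≤k
  ... | no  _    = subst (_≤ k l) (sym (∣⊥∣≡0 (v l))) z≤n

  point-⊆ : ∀ (T : (l : Fin m) → Subset (v l)) {i} {S : Subset (v i)} → S ⊆ T i → ∀ l → point i S l ⊆ T l
  point-⊆ T {i} S⊆Tᵢ l with l ≟ i
  ... | yes refl = S⊆Tᵢ
  ... | no  _    = ⊥⊆

  point-disjoint : ∀ {i j} (A : Subset (v i)) (B : Subset (v j)) → i ≢ j →
                   ∀ l → point i A l ≡ ⊥ ⊎ point j B l ≡ ⊥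
  point-disjoint {i} A B i≢j l with l ≟ i
  ... | yes refl = inj₂ (point-off B i≢j)
  ... | no  _    = inj₁ refl

  pair : (i : Fin m) → Fin (v i) → (j : Fin m) → Fin (v j) → (l : Fin m) → Subset (v l)
  pair i x j y l = point i ⁅ x ⁆ l ∪ point j ⁅ y ⁆ l

  module _ (k : Fin m → ℕ) where

    point-admissible : ∀ {i} {S : Subset (v i)} → ∣ S ∣ ≡ 2 → 2 ≤ k i → Admissible v k (point i S)
    point-admissible {i} {S} ∣S∣≡2 2≤kᵢ =
      point-size≤ k (subst (_≤ k i) (sym ∣S∣≡2) 2≤kᵢ) ,
      trans (∑≡sum (λ l → ∣ point i S l ∣)) (trans (∣point∣-sum i S) ∣S∣≡2)

    pair-admissible : ∀ {i j} → i ≢ j → 1 ≤ k i → 1 ≤ k j → ∀ x y → Admissible v k (pair i x j y)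
    pair-admissible {i} {j} i≢j kᵢ≥1 kⱼ≥1 x y = size≤ , size-sum
      where
      disjoint : ∀ l → point i ⁅ x ⁆ l ≡ ⊥ ⊎ point j ⁅ y ⁆ l ≡ ⊥
      disjoint = point-disjoint ⁅ x ⁆ ⁅ y ⁆ i≢j

      size≤ : ∀ l → ∣ pair i x j y l ∣ ≤ k l
      size≤ l = ∣∪∣-with-∅-≤ _ _ (disjoint l)
        (point-size≤ k (subst (_≤ k i) (sym (∣⁅x⁆∣≡1 x)) kᵢ≥1) l)
        (point-size≤ k (subst (_≤ k j) (sym (∣⁅x⁆∣≡1 y)) kⱼ≥1) l)

      size-sum : ∑ (λ l → ∣ pair i x j y l ∣) ≡ 2
      size-sum = begin
        ∑ (λ l → ∣ pair i x j y l ∣)                                  ≡⟨ ∑≡sum (λ l → ∣ pair i x j y l ∣) ⟩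
        sum (λ l → ∣ pair i x j y l ∣)                                ≡⟨ sum-cong-≗ (λ l → ∣∪∣-with-∅ _ _ (disjoint l)) ⟩
        sum (λ l → ∣ point i ⁅ x ⁆ l ∣ + ∣ point j ⁅ y ⁆ l ∣)          ≡⟨ ∑-distrib-+ (λ l → ∣ point i ⁅ x ⁆ l ∣) (λ l → ∣ point j ⁅ y ⁆ l ∣) ⟩
        sum (λ l → ∣ point i ⁅ x ⁆ l ∣) + sum (λ l → ∣ point j ⁅ y ⁆ l ∣)
          ≡⟨ cong₂ _+_ (trans (∣point∣-sum i ⁅ x ⁆) (∣⁅x⁆∣≡1 x)) (trans (∣point∣-sum j ⁅ y ⁆) (∣⁅x⁆∣≡1 y)) ⟩
        2                                                             ∎
        where open ≡-Reasoning

  pair-contained : ∀ {k : Fin m → ℕ} (β : Block v k) {i j x y} →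
                   x ∈ proj₁ β i → y ∈ proj₁ β j → ContainedIn (pair i x j y) β
  pair-contained β x∈βᵢ y∈βⱼ l = ∪-⊆ (point-⊆ (proj₁ β) (⁅⁆⊆ x∈βᵢ) l) (point-⊆ (proj₁ β) (⁅⁆⊆ y∈βⱼ) l)

module _ {m : ℕ} {v k : Fin m → ℕ} {d : ℕ} (P : GenPacking v k d) where
  open GenPacking P

  part : Fin d → (l : Fin m) → Subset (v l)
  part a = proj₁ (block a)

  part-size : ∀ a l → ∣ part a l ∣ ≡ k l
  part-size a = proj₂ (block a)

  restriction : ∀ i → 2 ≤ k i → Packing (v i) (k i) d
  restriction i 2≤kᵢ = record
    { block       = λ a → part a i
    ; block-size  = λ a → part-size a i
    ; at-most-one = λ a b a≢b T ∣T∣≡2 (T⊆Bₐ , T⊆B_b) →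
        at-most-one a b a≢b (point i T) (point-admissible k ∣T∣≡2 2≤kᵢ)
                    (point-⊆ (part a) T⊆Bₐ , point-⊆ (part b) T⊆B_b)
    }

  cross-pair-unique : ∀ {i j} → i ≢ j → 1 ≤ k i → 1 ≤ k j →
                      ∀ x y a b → x ∈ part a i → y ∈ part a j → x ∈ part b i → y ∈ part b j → a ≡ b
  cross-pair-unique i≢j kᵢ≥1 kⱼ≥1 x y a b x∈Bₐ y∈Bₐ x∈B_b y∈B_b with a ≟ b
  ... | yes a≡b = a≡b
  ... | no  a≢b = ⊥-elim (at-most-one a b a≢b (pair _ x _ y) (pair-admissible k i≢j kᵢ≥1 kⱼ≥1 x y)
                            (pair-contained (block a) x∈Bₐ y∈Bₐ , pair-contained (block b) x∈B_b y∈B_b))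

proposition3p5 : (m : ℕ) → 2 ≤ m → (v k : Fin m → ℕ) →
    (∀ i → 1 ≤ k i) → (∀ i → k i ≤ v i) →
    (d : ℕ) → IsGenD v k d →
    (∀ i → 2 ≤ k i → (e : ℕ) → IsD (v i) (k i) e → d ≤ e) ×
    (∀ i j → i ≢ j → d ≤ (v i * (v j div k j)) div k i)
proposition3p5 m _ v k k≥1 _ d (P , _) = classical-bound , cross-bound
  where
  classical-bound : ∀ i → 2 ≤ k i → (e : ℕ) → IsD (v i) (k i) e → d ≤ e
  classical-bound i 2≤kᵢ e (_ , maximal) = maximal d (restriction P i 2≤kᵢ)

  cross-bound : ∀ i j → i ≢ j → d ≤ (v i * (v j div k j)) div k i
  cross-bound i j i≢j =
    PairPacking.bound (λ a → part P a i) (λ a → part P a j)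
                      (λ a → part-size P a i) (λ a → part-size P a j)
                      (cross-pair-unique P i≢j (k≥1 i) (k≥1 j))
                      (k≥1 i) (k≥1 j)
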